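{- Let $n\ge 2$, $m\ge0$, let $r$ be a positive integer and $1\le i_1<i_2<\cdots<i_r\le n-1$. Then \[ \mathbb{P}\Bigl(\bigcap_{j=1}^r A_{i_j}\Bigr)=\mathbb{P}\Bigl(\bigcap_{j=1}^r A_{n-i_j}\Bigr), \] where $A_i$ is the event that $\boldsymbol\sigma(n,m)$ is decomposable at position $i$.
   Context: $\boldsymbol\sigma(n,m)$ is a uniformly random permutation of $[n]$ with exactly $m$ inversions (pairs of positions $i<j$ with $\sigma(i)>\sigma(j)$). A permutation $\boldsymbol\sigma$ of $[n]$ is decomposable at position $i\in[n-1]$ if $\{\sigma(1),\dots,\sigma(i)\}=\{1,\dots,i\}$. -}

module Defs where

open import Data.Nat using (ℕ; zero; suc; _<_; _≟_)
import Data.Nat as ℕ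
open import Data.Fin using (Fin; toℕ)
import Data.Fin as F
open import Data.Fin.Properties using (all?; any?)
import Data.Fin.Properties as FP
open import Data.Vec using (Vec; []; _∷_; lookup)
open import Data.List using (List; []; _∷_; map; concatMap; filter; length; allFin; cartesianProduct)
open import Data.Product using (Σ; ∃; _×_; _,_)
open import Relation.Binary.PropositionalEquality using (_≡_)
open import Relation.Nullary using (Dec)
open import Relation.Nullary.Decidable using (_×-dec_; _→-dec_)

-- A permutation σ of [n] in one-line notation: σ(k+1) = lookup σ k (positions/values 0-based in Fin n).
Word : ℕ → Set
Word n = Vec (Fin n) n

-- σ is a permutation iff it is injective (equivalently bijective, Fin n finite).
IsPerm : ∀ {n} → Word n → Set
IsPerm {n} σ = (a b : Fin n) → lookup σ a ≡ lookup σ b → a ≡ b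

isPerm? : ∀ {n} (σ : Word n) → Dec (IsPerm σ)
isPerm? σ = all? (λ a → all? (λ b → (lookup σ a FP.≟ lookup σ b) →-dec (a FP.≟ b)))

allWords : (n k : ℕ) → List (Vec (Fin n) k)
allWords n zero = [] ∷ []
allWords n (suc k) = concatMap (λ x → map (x ∷_) (allWords n k)) (allFin n)

inversions : ∀ {n} → Word n → ℕ
inversions {n} σ =
  length (filter (λ { (a , b) → (a F.<? b) ×-dec (lookup σ b F.<? lookup σ a) })
                 (cartesianProduct (allFin n) (allFin n)))

-- σ decomposable at position i (1-based):  {σ(1),…,σ(i)} = {1,…,i}
-- (⊆ and ⊇, written with 0-based Fin indices: position k is among the first i iff toℕ k < i)
Decomp : ∀ {n} → Word n → ℕ → Set
Decomp {n} σ i =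
  ((k : Fin n) → toℕ k < i → toℕ (lookup σ k) < i) ×
  ((l : Fin n) → toℕ l < i → ∃ λ (k : Fin n) → toℕ k < i × lookup σ k ≡ l)

decomp? : ∀ {n} (σ : Word n) (i : ℕ) → Dec (Decomp σ i)
decomp? σ i =
  all? (λ k → (toℕ k ℕ.<? i) →-dec (toℕ (lookup σ k) ℕ.<? i)) ×-dec
  all? (λ l → (toℕ l ℕ.<? i) →-dec any? (λ k → (toℕ k ℕ.<? i) ×-dec (lookup σ k FP.≟ l)))

countEvent : (n m r : ℕ) → (Fin r → ℕ) → ℕ
countEvent n m r i =
  length (filter (λ σ → isPerm? σ ×-dec (inversions σ ≟ m) ×-dec all? (λ j → decomp? σ (i j)))
                 (allWords n n))

module Submission where

-- For σ ∈ Sₙ let σʳᶜ(k) = n+1−σ(n+1−k), i.e. reverse the one-line word of σ and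
-- complement its values.  The map σ ↦ σʳᶜ is an involution of Sₙ which
--   (a) preserves the number of inversions, since (a,b) ↦ (n+1−b, n+1−a) is a
--       bijection from the inversions of σ to those of σʳᶜ, and
--   (b) sends "σ decomposable at i" to "σʳᶜ decomposable at n−i": σ maps the
--       block {1..i} onto itself iff it maps the complementary block {i+1..n}
--       onto itself, and reverse-complement exchanges the two blocks.
-- Hence it restricts to a bijection between {σ : inv σ = m, σ ∈ ⋂ⱼ A_{iⱼ}} and
-- {σ : inv σ = m, σ ∈ ⋂ⱼ A_{n−iⱼ}}, which gives the equality of counts.

open import Defs
open import Data.Nat using (ℕ; zero; suc; _≤_; _<_; _∸_; _<?_; s≤s)
open import Data.Nat.Properties
  using (≮⇒≥; ≤⇒≯; 1+n≰n; ∸-monoʳ-<; m∸[m∸n]≡n; m∸n≤m; ≤-trans; +-comm; m+n≤o⇒m≤o∸n; m≤o∸n⇒m+n≤o)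
open import Data.Fin using (Fin; toℕ; opposite; punchOut)
import Data.Fin as F
open import Data.Fin.Properties
  using (_≟_; opposite-prop; opposite-involutive; punchOut-injective; injective⇒≤; any?; toℕ<n)
open import Data.Vec using ([]; _∷_; lookup; tabulate)
open import Data.Vec.Properties using (lookup∘tabulate; tabulate∘lookup; tabulate-cong; ∷-injective)
open import Data.List
  using (List; []; _∷_; _++_; map; concatMap; filter; length; allFin; cartesianProduct; cartesianProductWith)
open import Data.List.Properties using (filter-≐)
open import Data.List.Membership.Propositional using (_∈_)
open import Data.List.Membership.Propositional.Properties
  using (∈-map⁺; ∈-allFin; ∈-cartesianProduct⁺; ∈-cartesianProductWith⁺)
open import Data.List.Membership.Propositional.Properties.WithK using (unique∧set⇒bag)
open import Data.List.Relation.Binary.BagAndSetEquality using (∼bag⇒↭)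
open import Data.List.Relation.Binary.Permutation.Propositional using (_↭_)
open import Data.List.Relation.Binary.Permutation.Propositional.Properties using (filter-↭; ↭-length)
open import Data.List.Relation.Unary.Unique.Propositional using (Unique; []; _∷_)
import Data.List.Relation.Unary.Unique.Propositional.Properties as Unique
open import Data.List.Relation.Unary.Any using (here)
import Data.List.Relation.Unary.All as All
open import Data.Product using (∃; _×_; _,_; proj₁; proj₂)
open import Function.Bundles using (mk⇔)
open import Relation.Binary.PropositionalEquality
  using (_≡_; _≢_; refl; sym; trans; cong; cong₂; subst; subst₂; module ≡-Reasoning)
open import Relation.Nullary using (yes; no; contradiction)
open import Relation.Unary using (Pred; Decidable)

module _ {A : Set} where

  record Enumeration (xs : List A) : Set where
    field
      unique   : Unique xs
      complete : ∀ x → x ∈ xs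

  length-filter-map : ∀ {q} {Q : Pred A q} (Q? : Decidable Q) (g : A → A) xs →
                      length (filter Q? (map g xs)) ≡ length (filter (λ x → Q? (g x)) xs)
  length-filter-map Q? g [] = refl
  length-filter-map Q? g (x ∷ xs) with Q? (g x)
  ... | yes _ = cong suc (length-filter-map Q? g xs)
  ... | no _  = length-filter-map Q? g xs

  -- An involution only permutes a finite enumeration: both lists are duplicate-free
  -- and contain every element, so they are bag-equal.
  map-involution-↭ : ∀ {xs} → Enumeration xs → (g : A → A) → (∀ x → g (g x) ≡ x) → map g xs ↭ xs
  map-involution-↭ {xs} enum g g∘g≡id =
    ∼bag⇒↭ (unique∧set⇒bag (Unique.map⁺ g-injective unique) unique (mk⇔ (λ _ → complete _) (λ _ → g-hits _)))
    where
      open Enumeration enum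
      g-injective : ∀ {x y} → g x ≡ g y → x ≡ y
      g-injective {x} {y} e = trans (sym (g∘g≡id x)) (trans (cong g e) (g∘g≡id y))
      g-hits : ∀ z → z ∈ map g xs
      g-hits z = subst (_∈ map g xs) (g∘g≡id z) (∈-map⁺ g (complete (g z)))

  count-involution : ∀ {p q} {P : Pred A p} {Q : Pred A q} (P? : Decidable P) (Q? : Decidable Q) →
                     ∀ {xs} → Enumeration xs → (g : A → A) → (∀ x → g (g x) ≡ x) →
                     (∀ {x} → P x → Q (g x)) → (∀ {x} → Q (g x) → P x) →
                     length (filter P? xs) ≡ length (filter Q? xs)
  count-involution P? Q? {xs} enum g g∘g≡id P⇒Qg Qg⇒P = begin
    length (filter P? xs)                ≡⟨ cong length (filter-≐ P? (λ x → Q? (g x)) (P⇒Qg , Qg⇒P) xs) ⟩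
    length (filter (λ x → Q? (g x)) xs)  ≡⟨ length-filter-map Q? g xs ⟨
    length (filter Q? (map g xs))        ≡⟨ ↭-length (filter-↭ Q? (map-involution-↭ enum g g∘g≡id)) ⟩
    length (filter Q? xs)                ∎
    where open ≡-Reasoning

allWords-suc : ∀ n k → allWords n (suc k) ≡ cartesianProductWith _∷_ (allFin n) (allWords n k)
allWords-suc n k = go (allFin n)
  where
    go : ∀ xs → concatMap (λ x → map (x ∷_) (allWords n k)) xs ≡ cartesianProductWith _∷_ xs (allWords n k)
    go []       = refl
    go (x ∷ xs) = cong (map (x ∷_) (allWords n k) ++_) (go xs)

allWords-enumeration : ∀ n k → Enumeration (allWords n k)
allWords-enumeration n zero = record { unique = All.[] ∷ [] ; complete = λ { [] → here refl } }
allWords-enumeration n (suc k) = record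
  { unique   = subst Unique (sym (allWords-suc n k))
                 (Unique.cartesianProductWith⁺ _∷_ ∷-injective (Unique.allFin⁺ n) unique)
  ; complete = λ { (x ∷ v) → subst ((x ∷ v) ∈_) (sym (allWords-suc n k))
                                (∈-cartesianProductWith⁺ _∷_ (∈-allFin x) (complete v)) }
  }
  where open Enumeration (allWords-enumeration n k)

pairs-enumeration : ∀ n → Enumeration (cartesianProduct (allFin n) (allFin n))
pairs-enumeration n = record
  { unique   = Unique.cartesianProduct⁺ (Unique.allFin⁺ n) (Unique.allFin⁺ n)
  ; complete = λ { (a , b) → ∈-cartesianProduct⁺ (∈-allFin a) (∈-allFin b) }
  }

opposite-injective : ∀ {n} {a b : Fin n} → opposite a ≡ opposite b → a ≡ b
opposite-injective {a = a} {b} e =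
  trans (sym (opposite-involutive a)) (trans (cong opposite e) (opposite-involutive b))

opposite-reverses-< : ∀ {n} {a b : Fin n} → a F.< b → opposite b F.< opposite a
opposite-reverses-< {a = a} {b} a<b =
  subst₂ _<_ (sym (opposite-prop b)) (sym (opposite-prop a)) (∸-monoʳ-< (s≤s a<b) (toℕ<n b))

opposite-reflects-< : ∀ {n} {a b : Fin n} → opposite b F.< opposite a → a F.< b
opposite-reflects-< {a = a} {b} h =
  subst₂ F._<_ (opposite-involutive a) (opposite-involutive b) (opposite-reverses-< h)

opposite-lower⇒upper : ∀ {n i} (k : Fin n) → i ≤ n → toℕ k < n ∸ i → i ≤ toℕ (opposite k)
opposite-lower⇒upper {n} {i} k i≤n k<n∸i = subst (i ≤_) (sym (opposite-prop k))
  (m+n≤o⇒m≤o∸n i (subst (_≤ n) (+-comm (suc (toℕ k)) i) (m≤o∸n⇒m+n≤o (suc (toℕ k)) i≤n k<n∸i)))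

opposite-upper⇒lower : ∀ {n i} (k : Fin n) → i ≤ toℕ k → toℕ (opposite k) < n ∸ i
opposite-upper⇒lower k i≤k = subst (_< _) (sym (opposite-prop k)) (∸-monoʳ-< (s≤s i≤k) (toℕ<n k))

-- An injective endofunction of a finite set is surjective (pigeonhole: a missed value
-- would give an injection Fin (suc n) → Fin n).
injective⇒surjective : ∀ {n} (h : Fin n → Fin n) → (∀ a b → h a ≡ h b → a ≡ b) → ∀ l → ∃ λ k → h k ≡ l
injective⇒surjective {suc n} h h-inj l with any? (λ k → h k ≟ l)
... | yes hit = hit
... | no miss = contradiction (injective⇒≤ squeezed-injective) 1+n≰n
  where
    h≢l : ∀ k → l ≢ h k
    h≢l k e = miss (k , sym e)
    squeezed : Fin (suc n) → Fin n
    squeezed k = punchOut (h≢l k)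
    squeezed-injective : ∀ {a b} → squeezed a ≡ squeezed b → a ≡ b
    squeezed-injective {a} {b} e = h-inj a b (punchOut-injective (h≢l a) (h≢l b) e)

module UpperBlock {n} (σ : Word n) (i : ℕ) (perm : IsPerm σ) (dec : Decomp σ i) where

  -- Values below i are all taken by positions below i, so an upper position has an upper value.
  maps-upper : ∀ k → i ≤ toℕ k → i ≤ toℕ (lookup σ k)
  maps-upper k i≤k with toℕ (lookup σ k) <? i
  ... | no  σk≮i = ≮⇒≥ σk≮i
  ... | yes σk<i with proj₂ dec (lookup σ k) σk<i
  ...   | k′ , k′<i , σk′≡σk = contradiction (subst (λ z → toℕ z < i) (perm k′ k σk′≡σk) k′<i) (≤⇒≯ i≤k)

  -- Every upper value is hit, and only by an upper position (lower positions have lower values).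
  covers-upper : ∀ l → i ≤ toℕ l → ∃ λ k → i ≤ toℕ k × lookup σ k ≡ l
  covers-upper l i≤l with injective⇒surjective (lookup σ) perm l
  ... | k , σk≡l with toℕ k <? i
  ...   | no  k≮i = k , ≮⇒≥ k≮i , σk≡l
  ...   | yes k<i = contradiction (subst (λ z → toℕ z < i) σk≡l (proj₁ dec k k<i)) (≤⇒≯ i≤l)

reverse-complement : ∀ {n} → Word n → Word n
reverse-complement σ = tabulate (λ k → opposite (lookup σ (opposite k)))

lookup-rc : ∀ {n} (σ : Word n) k → lookup (reverse-complement σ) k ≡ opposite (lookup σ (opposite k))
lookup-rc σ k = lookup∘tabulate _ k

lookup-rc-opposite : ∀ {n} (σ : Word n) k → lookup (reverse-complement σ) (opposite k) ≡ opposite (lookup σ k)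
lookup-rc-opposite σ k = trans (lookup-rc σ (opposite k)) (cong (λ z → opposite (lookup σ z)) (opposite-involutive k))

rc-involutive : ∀ {n} (σ : Word n) → reverse-complement (reverse-complement σ) ≡ σ
rc-involutive σ = trans (tabulate-cong (λ k → begin
    opposite (lookup (reverse-complement σ) (opposite k))  ≡⟨ cong opposite (lookup-rc-opposite σ k) ⟩
    opposite (opposite (lookup σ k))                       ≡⟨ opposite-involutive _ ⟩
    lookup σ k                                             ∎))
  (tabulate∘lookup σ)
  where open ≡-Reasoning

rc-perm : ∀ {n} (σ : Word n) → IsPerm σ → IsPerm (reverse-complement σ)
rc-perm σ perm a b e = opposite-injective (perm _ _ (opposite-injective
  (trans (sym (lookup-rc σ a)) (trans e (lookup-rc σ b)))))

mirror : ∀ {n} → Fin n × Fin n → Fin n × Fin n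
mirror (a , b) = opposite b , opposite a

mirror-involutive : ∀ {n} (p : Fin n × Fin n) → mirror (mirror p) ≡ p
mirror-involutive (a , b) = cong₂ _,_ (opposite-involutive a) (opposite-involutive b)

rc-inversions : ∀ {n} (σ : Word n) → inversions σ ≡ inversions (reverse-complement σ)
rc-inversions {n} σ = count-involution _ _ (pairs-enumeration n) mirror mirror-involutive
  (λ { {a , b} (a<b , σb<σa) → opposite-reverses-< a<b ,
         subst₂ F._<_ (sym (lookup-rc-opposite σ a)) (sym (lookup-rc-opposite σ b)) (opposite-reverses-< σb<σa) })
  (λ { {a , b} (a<b , σb<σa) → opposite-reflects-< a<b ,
         opposite-reflects-< (subst₂ F._<_ (lookup-rc-opposite σ a) (lookup-rc-opposite σ b) σb<σa) })

-- Decomposability at i becomes decomposability at n − i: the upper block of σ,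
-- which σ maps onto itself, is mirrored onto the lower block {k < n−i} of σʳᶜ.
rc-decomp : ∀ {n} (σ : Word n) i → i ≤ n → IsPerm σ → Decomp σ i → Decomp (reverse-complement σ) (n ∸ i)
rc-decomp {n} σ i i≤n perm dec = maps-lower , covers-lower
  where
    open UpperBlock σ i perm dec
    maps-lower : ∀ k → toℕ k < n ∸ i → toℕ (lookup (reverse-complement σ) k) < n ∸ i
    maps-lower k k<n∸i = subst (λ z → toℕ z < n ∸ i) (sym (lookup-rc σ k))
      (opposite-upper⇒lower _ (maps-upper (opposite k) (opposite-lower⇒upper k i≤n k<n∸i)))
    covers-lower : ∀ l → toℕ l < n ∸ i → ∃ λ k → toℕ k < n ∸ i × lookup (reverse-complement σ) k ≡ l
    covers-lower l l<n∸i with covers-upper (opposite l) (opposite-lower⇒upper l i≤n l<n∸i)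
    ... | k , i≤k , σk≡l′ = opposite k , opposite-upper⇒lower k i≤k ,
      trans (lookup-rc-opposite σ k) (trans (cong opposite σk≡l′) (opposite-involutive l))

Event : ∀ {n} (m r : ℕ) → (Fin r → ℕ) → Word n → Set
Event m r i σ = IsPerm σ × inversions σ ≡ m × (∀ j → Decomp σ (i j))

event-cong : ∀ {n m r} {i i′ : Fin r → ℕ} {σ : Word n} → (∀ j → i j ≡ i′ j) → Event m r i σ → Event m r i′ σ
event-cong {σ = σ} i≡i′ (perm , inv≡m , decs) = perm , inv≡m , λ j → subst (Decomp σ) (i≡i′ j) (decs j)

rc-event : ∀ {n m r} (i : Fin r → ℕ) → (∀ j → i j ≤ n) → ∀ σ →
           Event m r i σ → Event m r (λ j → n ∸ i j) (reverse-complement σ)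
rc-event i i≤n σ (perm , inv≡m , decs) =
  rc-perm σ perm , trans (sym (rc-inversions σ)) inv≡m , λ j → rc-decomp σ (i j) (i≤n j) perm (decs j)

-- Conversely, σ has the event at positions i j when σʳᶜ has it at positions n − i j,
-- since reverse-complement is an involution and n − (n − i) = i.
rc-event⁻¹ : ∀ {n m r} (i : Fin r → ℕ) → (∀ j → i j ≤ n) → ∀ σ →
             Event m r (λ j → n ∸ i j) (reverse-complement σ) → Event m r i σ
rc-event⁻¹ {n} {m} {r} i i≤n σ e = subst (Event m r i) (rc-involutive σ)
  (event-cong {i = λ j → n ∸ (n ∸ i j)} {σ = reverse-complement (reverse-complement σ)}
    (λ j → m∸[m∸n]≡n (i≤n j))
    (rc-event (λ j → n ∸ i j) (λ j → m∸n≤m n (i j)) (reverse-complement σ) e))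

lemma3p2 : (n m r : ℕ) → 2 ≤ n → 1 ≤ r →
    (i : Fin r → ℕ) →
    ((a b : Fin r) → a F.< b → i a < i b) →
    ((j : Fin r) → 1 ≤ i j × i j ≤ n ∸ 1) →
    countEvent n m r i ≡ countEvent n m r (λ j → n ∸ i j)
lemma3p2 n m r _ _ i _ bounds =
  count-involution _ _ (allWords-enumeration n n) reverse-complement rc-involutive
    (λ {σ} → rc-event i i≤n σ) (λ {σ} → rc-event⁻¹ i i≤n σ)
  where
    i≤n : ∀ j → i j ≤ n
    i≤n j = ≤-trans (proj₂ (bounds j)) (m∸n≤m n 1)
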